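{- Let $q$ be a prime power and $n\ge1$. The number of matrices in $GL_n(\mathbb{F}_q)$ whose sum of entries (computed in $\mathbb{F}_q$) equals $0$ is exactly $$[n-1]_q!\,(q-1)^{n-1}q^{\binom n2}(q^{n-1}-1),$$ while for every nonzero element $a\in\mathbb{F}_q$, the number of matrices in $GL_n(\mathbb{F}_q)$ whose entries add up to $a$ in $\mathbb{F}_q$ is $$[n-1]_q!\,(q-1)^{n-1}q^{\binom n2+n-1}.$$
   Context: For an integer $m\ge1$, $[m]_q=1+q+\cdots+q^{m-1}$ and $[m]_q!=[m]_q[m-1]_q\cdots[1]_q$, with $[0]_q!=1$. -}

module Defs where

open import Level using (Level; _⊔_)
open import Data.Nat as ℕ using (ℕ; zero; suc; _∸_; _^_)
open import Data.Nat.Combinatorics using (_C_)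
open import Data.Fin as Fin using (Fin; zero; suc; _≟_)
open import Data.Product using (Σ; ∃; _×_; proj₁)
open import Relation.Nullary using (¬_; yes; no)
open import Relation.Binary.Bundles using (Setoid)
import Relation.Binary.PropositionalEquality as ≡
import Relation.Binary.Construct.On as On
open import Function.Bundles using (Inverse)
open import Algebra.Bundles using (CommutativeRing)

record Field (c ℓ : Level) : Set (Level.suc (c ⊔ ℓ)) where
  field
    commutativeRing : CommutativeRing c ℓ
  open CommutativeRing commutativeRing public
  field
    0≉1     : ¬ (0# ≈ 1#)
    inverse : ∀ x → ¬ (x ≈ 0#) → ∃ λ y → x * y ≈ 1#

HasCard : ∀ {a ℓ} → Setoid a ℓ → ℕ → Set _
HasCard S N = Inverse (≡.setoid (Fin N)) S

qint : ℕ → ℕ → ℕ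
qint q zero    = 0
qint q (suc m) = q ^ m ℕ.+ qint q m

qfact : ℕ → ℕ → ℕ
qfact q zero    = 1
qfact q (suc m) = qint q (suc m) ℕ.* qfact q m

module MatrixDefs {c ℓ} (F : Field c ℓ) where
  open Field F hiding (zero)

  Matrix : ℕ → Set c
  Matrix n = Fin n → Fin n → Carrier

  sumF : ∀ {m} → (Fin m → Carrier) → Carrier
  sumF {zero}  f = 0#
  sumF {suc m} f = f zero + sumF (λ i → f (suc i))

  _≈M_ : ∀ {n} → Matrix n → Matrix n → Set ℓ
  A ≈M B = ∀ i j → A i j ≈ B i j

  _⊗_ : ∀ {n} → Matrix n → Matrix n → Matrix n
  (A ⊗ B) i j = sumF (λ k → A i k * B k j)

  I : ∀ {n} → Matrix n
  I i j with i ≟ j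
  ... | yes _ = 1#
  ... | no  _ = 0#

  Invertible : ∀ {n} → Matrix n → Set (c ⊔ ℓ)
  Invertible {n} A = Σ (Matrix n) λ B → (A ⊗ B) ≈M I × (B ⊗ A) ≈M I

  entrySum : ∀ {n} → Matrix n → Carrier
  entrySum A = sumF (λ i → sumF (λ j → A i j))

  matrixSetoid : ℕ → Setoid c ℓ
  matrixSetoid n = record
    { Carrier = Matrix n
    ; _≈_ = _≈M_
    ; isEquivalence = record
      { refl = λ i j → refl
      ; sym = λ p i j → sym (p i j)
      ; trans = λ p q i j → trans (p i j) (q i j) } }

  GLsum : ℕ → Carrier → Setoid (c ⊔ ℓ) ℓ
  GLsum n a = On.setoid {B = Σ (Matrix n) λ A → Invertible A × entrySum A ≈ a}
                (matrixSetoid n) proj₁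

-- Right multiplication by the invertible matrix whose first column is all ones (and which is the
-- identity elsewhere) replaces the first column of A by its row sums, so it suffices to count
-- invertible matrices by the sum of their first column. The first column of an invertible matrix
-- is a nonzero vector, and for every nonzero x, left multiplication by an invertible matrix with
-- first column x maps the invertible matrices with first column e₀ onto those with first column x.
-- The former are the block matrices [1 r; 0 D] with r arbitrary and D ∈ GL_{n-1}, so every fibre
-- has q^{n-1} |GL_{n-1}| elements. Hence |GL_n| = (q^n - 1) q^{n-1} |GL_{n-1}|, and the number with
-- entry sum a is q^{n-1} |GL_{n-1}| times the number of nonzero x ∈ F^n with coordinate sum a,
-- which is q^{n-1} - 1 for a = 0 and q^{n-1} otherwise.

module Submission where

open import Level using (Level; _⊔_)
open import Data.Empty using (⊥-elim)
open import Data.Nat as ℕ using (ℕ; zero; suc; _∸_; _^_)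
open import Data.Fin as Fin using (Fin; zero; suc; punchIn; punchOut)
open import Data.Fin.Properties
  using (¬Fin0; *↔×; punchInᵢ≢i; punchOut-cong; punchIn-punchOut; punchOut-punchIn; ¬∀⟶∃¬)
open import Data.Fin.Permutation using (Permutation′; _⟨$⟩ʳ_; _⟨$⟩ˡ_; inverseˡ; flip; transpose)
open import Data.Product using (Σ; _×_; _,_; proj₁; proj₂)
open import Data.Unit using (⊤; tt)
open import Data.Product.Relation.Binary.Pointwise.NonDependent
  using (Pointwise; _×ₛ_; Pointwise-≡↔≡)
open import Data.Product.Function.NonDependent.Setoid using (_×-inverse_)
open import Function using (_∘_)
open import Data.Vec.Functional using (Vector; _∷_; head; tail; replicate)
open import Function.Bundles using (Inverse; Func; Injection)
open import Function.Properties.Inverse using (Inverse⇒Injection)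
import Function.Construct.Composition as Composition
import Function.Construct.Symmetry as Symmetry
import Function.Construct.Identity as Identity
open import Relation.Nullary using (¬_; yes; no)
import Relation.Nullary.Decidable as Dec
open import Relation.Binary.Bundles using (Setoid)
open import Relation.Binary.Definitions using (Decidable)
import Relation.Binary.Construct.On as On
open import Relation.Binary.PropositionalEquality as ≡ using (_≡_)
open import Defs

private variable
  a b c ℓa ℓb ℓc p p′ : Level

-- Counting finite setoids

Subsetoid : (S : Setoid a ℓa) → (Setoid.Carrier S → Set p) → Setoid (a ⊔ p) ℓa
Subsetoid S P = On.setoid {B = Σ (Setoid.Carrier S) P} S proj₁

infixr 9 _⨾_

_⨾_ : {R : Setoid a ℓa} {S : Setoid b ℓb} {T : Setoid c ℓc} →
      Inverse R S → Inverse S T → Inverse R T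
_⨾_ = Composition.inverse

module _ {S : Setoid a ℓa} {T : Setoid b ℓb} where
  private
    module S = Setoid S
    module T = Setoid T

  mkInverse : (to : S.Carrier → T.Carrier) (from : T.Carrier → S.Carrier) →
              (∀ {x y} → x S.≈ y → to x T.≈ to y) →
              (∀ {x y} → x T.≈ y → from x S.≈ from y) →
              (∀ y → to (from y) T.≈ y) → (∀ x → from (to x) S.≈ x) →
              Inverse S T
  mkInverse to from to-cong from-cong to∘from from∘to = record
    { to        = to
    ; from      = from
    ; to-cong   = to-cong
    ; from-cong = from-cong
    ; inverse   = (λ {y} x≈from[y] → T.trans (to-cong x≈from[y]) (to∘from y))
                , (λ {x} y≈to[x] → S.trans (from-cong y≈to[x]) (from∘to x))
    }

module _ {S : Setoid a ℓa} {T : Setoid b ℓb} where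
  private
    module S = Setoid S
    module T = Setoid T

  Subsetoid-inverse : (f : Inverse S T) {P : S.Carrier → Set p} {Q : T.Carrier → Set p′} →
                      (∀ {x} → P x → Q (Inverse.to f x)) →
                      (∀ {y} → Q y → P (Inverse.from f y)) →
                      Inverse (Subsetoid S P) (Subsetoid T Q)
  Subsetoid-inverse f P⇒Q Q⇒P = mkInverse
    (λ (x , px) → Inverse.to f x , P⇒Q px) (λ (y , qy) → Inverse.from f y , Q⇒P qy)
    (Inverse.to-cong f) (Inverse.from-cong f)
    (Inverse.strictlyInverseˡ f ∘ proj₁) (Inverse.strictlyInverseʳ f ∘ proj₁)

module _ {S : Setoid a ℓa} where
  private
    module S = Setoid S

  Subsetoid-cong : {P : S.Carrier → Set p} {Q : S.Carrier → Set p′} →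
                   (∀ {x} → P x → Q x) → (∀ {x} → Q x → P x) →
                   Inverse (Subsetoid S P) (Subsetoid S Q)
  Subsetoid-cong = Subsetoid-inverse (Identity.inverse S)

  Subsetoid-∩ : {P : S.Carrier → Set p} {Q : S.Carrier → Set p′} →
                Inverse (Subsetoid (Subsetoid S P) (Q ∘ proj₁)) (Subsetoid S (λ x → P x × Q x))
  Subsetoid-∩ = mkInverse
    (λ ((x , px) , qx) → x , px , qx) (λ (x , px , qx) → (x , px) , qx)
    (λ x≈y → x≈y) (λ x≈y → x≈y) (λ _ → S.refl) (λ _ → S.refl)

  HasCard-decidable : ∀ {N} → HasCard S N → Decidable S._≈_
  HasCard-decidable card x y =
    Dec.map′ (Injection.injective (Inverse⇒Injection (Symmetry.inverse card))) (Inverse.from-cong card)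
             (Inverse.from card x Fin.≟ Inverse.from card y)

  HasCard-remove : ∀ {N} → HasCard S N → (s₀ : S.Carrier) →
                   HasCard (Subsetoid S (λ x → ¬ x S.≈ s₀)) (N ∸ 1)
  HasCard-remove {zero}  card s₀ = ⊥-elim (¬Fin0 (Inverse.from card s₀))
  HasCard-remove {suc N} card s₀ = mkInverse to from
    (S.reflexive ∘ ≡.cong (elem ∘ punchIn i₀)) (punchOut-cong i₀ ∘ index-cong)
    (λ (x , _) → S.trans (S.reflexive (≡.cong elem (punchIn-punchOut _))) (elem∘index x))
    (λ i → ≡.trans (punchOut-cong i₀ (index∘elem (punchIn i₀ i))) (punchOut-punchIn i₀))
    where
    open Inverse card using () renaming
      (to to elem; from to index; from-cong to index-cong;
       strictlyInverseˡ to elem∘index; strictlyInverseʳ to index∘elem)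
    i₀ = index s₀
    to : Fin N → Σ S.Carrier (λ x → ¬ x S.≈ s₀)
    to i = elem (punchIn i₀ i) , λ e →
      punchInᵢ≢i i₀ i (≡.trans (≡.sym (index∘elem _)) (index-cong e))
    from : Σ S.Carrier (λ x → ¬ x S.≈ s₀) → Fin N
    from (x , x≉s₀) = punchOut {i = i₀} {j = index x} λ i₀≡ix →
      x≉s₀ (S.trans (S.sym (elem∘index x))
             (S.trans (S.reflexive (≡.cong elem (≡.sym i₀≡ix))) (elem∘index s₀)))

module _ {S : Setoid a ℓa} {T : Setoid b ℓb} (h : Func S T) where
  private
    module S = Setoid S
    module T = Setoid T
    module h = Func h

  fibre : T.Carrier → Setoid (a ⊔ ℓb) ℓa
  fibre t = Subsetoid S (λ x → h.to x T.≈ t)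

  HasCard-fibres : ∀ {N M} → HasCard T N → (∀ t → HasCard (fibre t) M) → HasCard S (N ℕ.* M)
  HasCard-fibres {N} {M} card cardᶠ =
    *↔× ⨾ Symmetry.inverse Pointwise-≡↔≡ ⨾ mkInverse to from to-cong from-cong to∘from from∘to
    where
    module B = Inverse card
    module F (i : Fin N) = Inverse (cardᶠ (B.to i))
    to : Fin N × Fin M → S.Carrier
    to (i , j) = proj₁ (F.to i j)
    base : S.Carrier → Fin N
    base x = B.from (h.to x)
    from : S.Carrier → Fin N × Fin M
    from x = base x , F.from (base x) (x , T.sym (B.strictlyInverseˡ (h.to x)))
    F-from-cong : ∀ {i i′ x x′ p p′} → i ≡ i′ → x S.≈ x′ →
                  F.from i (x , p) ≡ F.from i′ (x′ , p′)
    F-from-cong {i} ≡.refl = F.from-cong i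
    to-cong : ∀ {u v} → Pointwise _≡_ _≡_ u v → to u S.≈ to v
    to-cong (≡.refl , ≡.refl) = S.refl
    from-cong : ∀ {x y} → x S.≈ y → Pointwise _≡_ _≡_ (from x) (from y)
    from-cong x≈y = let base≡ = B.from-cong (h.cong x≈y) in base≡ , F-from-cong base≡ x≈y
    to∘from : ∀ x → to (from x) S.≈ x
    to∘from x = F.strictlyInverseˡ (base x) _
    from∘to : ∀ u → Pointwise _≡_ _≡_ (from (to u)) u
    from∘to (i , j) = base≡i , ≡.trans (F-from-cong base≡i S.refl) (F.strictlyInverseʳ i j)
      where
      base≡i : base (to (i , j)) ≡ i
      base≡i = ≡.trans (B.from-cong (proj₂ (F.to i j))) (B.strictlyInverseʳ i)

HasCard-× : ∀ {S : Setoid a ℓa} {T : Setoid b ℓb} {N M} →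
            HasCard S N → HasCard T M → HasCard (S ×ₛ T) (N ℕ.* M)
HasCard-× cardS cardT = *↔× ⨾ Symmetry.inverse Pointwise-≡↔≡ ⨾ (cardS ×-inverse cardT)

∣GL∣ : ℕ → ℕ → ℕ
∣GL∣ q zero    = 1
∣GL∣ q (suc n) = (q ^ suc n ∸ 1) ℕ.* (q ^ n ℕ.* ∣GL∣ q n)

-- Matrices over a field

module _ {c ℓ} (F : Field c ℓ) where
  open Field F hiding (zero)
  open MatrixDefs F
  open import Algebra.Properties.Semiring.Sum semiring
    using (sum; sum-cong-≋; sum-replicate-zero; ∑-comm; *-distribˡ-sum; *-distribʳ-sum)
  open import Data.Vec.Functional.Relation.Binary.Equality.Setoid setoid
    using (_≋_; ≋-setoid)
  open import Algebra.Properties.Ring ring using (-‿distribˡ-*)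
  open import Algebra.Properties.Group +-group using (//-rightDividesˡ; //-rightDividesʳ)
  open import Relation.Binary.Reasoning.Setoid setoid

  private variable
    m n : ℕ

  sumF≡sum : (f : Vector Carrier n) → sumF f ≡ sum f
  sumF≡sum {zero}  f = ≡.refl
  sumF≡sum {suc n} f = ≡.cong (f zero +_) (sumF≡sum (f ∘ suc))

  sumF-cong : {f g : Vector Carrier n} → f ≋ g → sumF f ≈ sumF g
  sumF-cong {f = f} {g} f≋g = begin
    sumF f ≡⟨ sumF≡sum f ⟩
    sum f  ≈⟨ sum-cong-≋ f≋g ⟩
    sum g  ≡⟨ sumF≡sum g ⟨
    sumF g ∎

  sumF-*ˡ : ∀ x (f : Vector Carrier n) → sumF (λ i → x * f i) ≈ x * sumF f
  sumF-*ˡ x f = begin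
    sumF (λ i → x * f i) ≡⟨ sumF≡sum (λ i → x * f i) ⟩
    sum (λ i → x * f i)  ≈⟨ *-distribˡ-sum x f ⟨
    x * sum f            ≡⟨ ≡.cong (x *_) (sumF≡sum f) ⟨
    x * sumF f           ∎

  sumF-*ʳ : ∀ x (f : Vector Carrier n) → sumF (λ i → f i * x) ≈ sumF f * x
  sumF-*ʳ x f = begin
    sumF (λ i → f i * x) ≡⟨ sumF≡sum (λ i → f i * x) ⟩
    sum (λ i → f i * x)  ≈⟨ *-distribʳ-sum x f ⟨
    sum f * x            ≡⟨ ≡.cong (_* x) (sumF≡sum f) ⟨
    sumF f * x           ∎

  sumF-0 : {f : Vector Carrier n} → (∀ i → f i ≈ 0#) → sumF f ≈ 0#
  sumF-0 {n} {f} f≈0 = begin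
    sumF f                 ≈⟨ sumF-cong f≈0 ⟩
    sumF (replicate n 0#)  ≡⟨ sumF≡sum (replicate n 0#) ⟩
    sum (replicate n 0#)   ≈⟨ sum-replicate-zero n ⟩
    0#                     ∎

  sumF-comm : (f : Fin m → Fin n → Carrier) →
              sumF (λ i → sumF (λ j → f i j)) ≈ sumF (λ j → sumF (λ i → f i j))
  sumF-comm f = begin
    sumF (λ i → sumF (λ j → f i j)) ≈⟨ sumF-cong (λ i → reflexive (sumF≡sum (f i))) ⟩
    sumF (λ i → sum (λ j → f i j))  ≡⟨ sumF≡sum (λ i → sum (f i)) ⟩
    sum (λ i → sum (λ j → f i j))   ≈⟨ ∑-comm f ⟩
    sum (λ j → sum (λ i → f i j))   ≡⟨ sumF≡sum (λ j → sum (λ i → f i j)) ⟨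
    sumF (λ j → sum (λ i → f i j))  ≈⟨ sumF-cong (λ j → reflexive (sumF≡sum (λ i → f i j))) ⟨
    sumF (λ j → sumF (λ i → f i j)) ∎

  I-suc : (i j : Fin n) → I (suc i) (suc j) ≡ I i j
  I-suc i j with i Fin.≟ j
  ... | yes _ = ≡.refl
  ... | no  _ = ≡.refl

  I-sym : (i j : Fin n) → I i j ≡ I j i
  I-sym zero    zero    = ≡.refl
  I-sym zero    (suc j) = ≡.refl
  I-sym (suc i) zero    = ≡.refl
  I-sym (suc i) (suc j) = ≡.trans (I-suc i j) (≡.trans (I-sym i j) (≡.sym (I-suc j i)))

  sumF-δˡ : (i : Fin n) (f : Vector Carrier n) → sumF (λ k → I i k * f k) ≈ f i
  sumF-δˡ zero    f = begin
    1# * f zero + sumF (λ k → 0# * f (suc k))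
      ≈⟨ +-cong (*-identityˡ _) (sumF-0 (λ k → zeroˡ (f (suc k)))) ⟩
    f zero + 0#  ≈⟨ +-identityʳ _ ⟩
    f zero       ∎
  sumF-δˡ (suc i) f = begin
    0# * f zero + sumF (λ k → I (suc i) (suc k) * f (suc k))
      ≈⟨ +-cong (zeroˡ _) (sumF-cong (λ k → *-congʳ (reflexive (I-suc i k)))) ⟩
    0# + sumF (λ k → I i k * f (suc k))  ≈⟨ +-identityˡ _ ⟩
    sumF (λ k → I i k * f (suc k))       ≈⟨ sumF-δˡ i (f ∘ suc) ⟩
    f (suc i)                            ∎

  sumF-δʳ : (j : Fin n) (f : Vector Carrier n) → sumF (λ k → f k * I k j) ≈ f j
  sumF-δʳ j f =
    trans (sumF-cong (λ k → trans (*-comm (f k) _) (*-congʳ (reflexive (I-sym k j))))) (sumF-δˡ j f)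

  private
    module M {n} = Setoid (matrixSetoid n)

  infixr 7 _⊗ᵥ_ _ᵥ⊗_

  _⊗ᵥ_ : Matrix n → Vector Carrier n → Vector Carrier n
  (A ⊗ᵥ x) i = sumF (λ k → A i k * x k)

  _ᵥ⊗_ : Vector Carrier n → Matrix n → Vector Carrier n
  (x ᵥ⊗ A) j = sumF (λ k → x k * A k j)

  ⊗-cong : {A A′ B B′ : Matrix n} → A ≈M A′ → B ≈M B′ → (A ⊗ B) ≈M (A′ ⊗ B′)
  ⊗-cong A≈A′ B≈B′ i j = sumF-cong (λ k → *-cong (A≈A′ i k) (B≈B′ k j))

  ⊗ᵥ-congʳ : (A : Matrix n) {x y : Vector Carrier n} → x ≋ y → A ⊗ᵥ x ≋ A ⊗ᵥ y
  ⊗ᵥ-congʳ A x≋y i = sumF-cong (λ k → *-congˡ (x≋y k))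

  ᵥ⊗-assoc : (x : Vector Carrier n) (A B : Matrix n) → (x ᵥ⊗ A) ᵥ⊗ B ≋ x ᵥ⊗ (A ⊗ B)
  ᵥ⊗-assoc x A B j = begin
    sumF (λ k → sumF (λ l → x l * A l k) * B k j)
      ≈⟨ sumF-cong (λ k → sumF-*ʳ (B k j) (λ l → x l * A l k)) ⟨
    sumF (λ k → sumF (λ l → x l * A l k * B k j))
      ≈⟨ sumF-comm (λ k l → x l * A l k * B k j) ⟩
    sumF (λ l → sumF (λ k → x l * A l k * B k j))
      ≈⟨ sumF-cong (λ l → sumF-cong (λ k → *-assoc (x l) (A l k) (B k j))) ⟩
    sumF (λ l → sumF (λ k → x l * (A l k * B k j)))
      ≈⟨ sumF-cong (λ l → sumF-*ˡ (x l) (λ k → A l k * B k j)) ⟩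
    sumF (λ l → x l * sumF (λ k → A l k * B k j)) ∎

  ⊗-assoc : (A B C : Matrix n) → ((A ⊗ B) ⊗ C) ≈M (A ⊗ (B ⊗ C))
  ⊗-assoc A B C i = ᵥ⊗-assoc (A i) B C

  ⊗-identityˡ : (A : Matrix n) → (I ⊗ A) ≈M A
  ⊗-identityˡ A i j = sumF-δˡ i (λ k → A k j)

  ⊗-identityʳ : (A : Matrix n) → (A ⊗ I) ≈M A
  ⊗-identityʳ A i j = sumF-δʳ j (A i)

  ⊗-cancelˡ : {A B : Matrix n} → (A ⊗ B) ≈M I → ∀ C → (A ⊗ (B ⊗ C)) ≈M C
  ⊗-cancelˡ {A = A} {B} AB C = M.trans (M.sym (⊗-assoc A B C)) (M.trans (⊗-cong AB M.refl) (⊗-identityˡ C))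

  ⊗-cancelʳ : {A B : Matrix n} → (A ⊗ B) ≈M I → ∀ C → ((C ⊗ A) ⊗ B) ≈M C
  ⊗-cancelʳ {A = A} {B} AB C = M.trans (⊗-assoc C A B) (M.trans (⊗-cong M.refl AB) (⊗-identityʳ C))

  Invertible-resp : {A B : Matrix n} → A ≈M B → Invertible A → Invertible B
  Invertible-resp A≈B (A⁻¹ , AA⁻¹ , A⁻¹A) =
    A⁻¹ , M.trans (⊗-cong (M.sym A≈B) M.refl) AA⁻¹ , M.trans (⊗-cong M.refl (M.sym A≈B)) A⁻¹A

  Invertible-⊗ : {A B : Matrix n} → Invertible A → Invertible B → Invertible (A ⊗ B)
  Invertible-⊗ {A = A} {B} (A⁻¹ , AA⁻¹ , A⁻¹A) (B⁻¹ , BB⁻¹ , B⁻¹B) =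
    B⁻¹ ⊗ A⁻¹ ,
    M.trans (⊗-assoc A B _) (M.trans (⊗-cong M.refl (⊗-cancelˡ BB⁻¹ A⁻¹)) AA⁻¹) ,
    M.trans (⊗-assoc B⁻¹ A⁻¹ _) (M.trans (⊗-cong M.refl (⊗-cancelˡ A⁻¹A B)) B⁻¹B)

  GL : ∀ {p} n → (Matrix n → Set p) → Setoid (c ⊔ ℓ ⊔ p) ℓ
  GL n P = Subsetoid (matrixSetoid n) (λ A → Invertible A × P A)

  module _ (A B : Matrix n) (AB : (A ⊗ B) ≈M I) (BA : (B ⊗ A) ≈M I)
           {P : Matrix n → Set p} {Q : Matrix n → Set p′} where

    GL-⊗ˡ-inverse : (∀ {C} → P C → Q (A ⊗ C)) → (∀ {C} → Q C → P (B ⊗ C)) →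
                    Inverse (GL n P) (GL n Q)
    GL-⊗ˡ-inverse P⇒Q Q⇒P = Subsetoid-inverse
      (mkInverse (A ⊗_) (B ⊗_) (⊗-cong M.refl) (⊗-cong M.refl) (⊗-cancelˡ AB) (⊗-cancelˡ BA))
      (λ (C-inv , pC) → Invertible-⊗ (B , AB , BA) C-inv , P⇒Q pC)
      (λ (C-inv , qC) → Invertible-⊗ (A , BA , AB) C-inv , Q⇒P qC)

    GL-⊗ʳ-inverse : (∀ {C} → P C → Q (C ⊗ A)) → (∀ {C} → Q C → P (C ⊗ B)) →
                    Inverse (GL n P) (GL n Q)
    GL-⊗ʳ-inverse P⇒Q Q⇒P = Subsetoid-inverse
      (mkInverse (_⊗ A) (_⊗ B) (λ e → ⊗-cong e M.refl) (λ e → ⊗-cong e M.refl)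
                 (⊗-cancelʳ BA) (⊗-cancelʳ AB))
      (λ (C-inv , pC) → Invertible-⊗ C-inv (B , AB , BA) , P⇒Q pC)
      (λ (C-inv , qC) → Invertible-⊗ C-inv (A , BA , AB) , Q⇒P qC)

  0ᵥ : Vector Carrier n
  0ᵥ _ = 0#

  ≉0ᵥ-resp : {x y : Vector Carrier n} → x ≋ y → ¬ x ≋ 0ᵥ → ¬ y ≋ 0ᵥ
  ≉0ᵥ-resp x≋y x≉0 y≋0 = x≉0 (λ i → trans (x≋y i) (y≋0 i))

  column₀ : Matrix (suc n) → Vector Carrier (suc n)
  column₀ A i = A i zero

  e₀ : Vector Carrier (suc n)
  e₀ = column₀ I

  ⊗ᵥ-e₀ : (A : Matrix (suc n)) → A ⊗ᵥ e₀ ≋ column₀ A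
  ⊗ᵥ-e₀ A i = sumF-δʳ zero (A i)

  I[col₀≔_] : Vector Carrier (suc n) → Matrix (suc n)
  I[col₀≔ x ] i zero    = x i
  I[col₀≔ x ] i (suc j) = I i (suc j)

  I[col₀≔]-cong : {x y : Vector Carrier (suc n)} → x ≋ y → I[col₀≔ x ] ≈M I[col₀≔ y ]
  I[col₀≔]-cong x≋y i zero    = x≋y i
  I[col₀≔]-cong x≋y i (suc j) = refl

  I[col₀≔e₀] : I[col₀≔ e₀ {n} ] ≈M I
  I[col₀≔e₀] i zero    = refl
  I[col₀≔e₀] i (suc j) = refl

  I[col₀≔]-⊗ : (x y : Vector Carrier (suc n)) →
               (I[col₀≔ x ] ⊗ I[col₀≔ y ]) ≈M I[col₀≔ I[col₀≔ x ] ⊗ᵥ y ]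
  I[col₀≔]-⊗ x y i zero    = refl
  I[col₀≔]-⊗ x y i (suc j) = sumF-δʳ (suc j) (I[col₀≔ x ] i)

  I[col₀≔]-invertible : (x : Vector Carrier (suc n)) {u : Carrier} → x zero * u ≈ 1# →
                        Invertible I[col₀≔ x ]
  I[col₀≔]-invertible {n} x {u} xu≈1 =
    I[col₀≔ y ] , right-inverse x y xy≈e₀ , right-inverse y x yx≈e₀
    where
    y : Vector Carrier (suc n)
    y zero    = u
    y (suc i) = - (x (suc i) * u)
    right-inverse : ∀ x y → I[col₀≔ x ] ⊗ᵥ y ≋ e₀ → (I[col₀≔ x ] ⊗ I[col₀≔ y ]) ≈M I
    right-inverse x y e = M.trans (I[col₀≔]-⊗ x y) (M.trans (I[col₀≔]-cong e) I[col₀≔e₀])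
    tail-entry : ∀ x y (i : Fin n) → (I[col₀≔ x ] ⊗ᵥ y) (suc i) ≈ x (suc i) * y zero + y (suc i)
    tail-entry x y i =
      +-congˡ (trans (sumF-cong (λ k → *-congʳ (reflexive (I-suc i k)))) (sumF-δˡ i (y ∘ suc)))
    head-entry : ∀ x y → (I[col₀≔ x ] ⊗ᵥ y) zero ≈ x zero * y zero
    head-entry x y = trans (+-congˡ (sumF-0 (λ k → zeroˡ (y (suc k))))) (+-identityʳ _)
    xy≈e₀ : I[col₀≔ x ] ⊗ᵥ y ≋ e₀
    xy≈e₀ zero    = trans (head-entry x y) xu≈1
    xy≈e₀ (suc i) = trans (tail-entry x y i) (-‿inverseʳ _)
    yx≈e₀ : I[col₀≔ y ] ⊗ᵥ x ≋ e₀
    yx≈e₀ zero    = trans (head-entry y x) (trans (*-comm u _) xu≈1)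
    yx≈e₀ (suc i) = begin
      (I[col₀≔ y ] ⊗ᵥ x) (suc i)              ≈⟨ tail-entry y x i ⟩
      - (x (suc i) * u) * x zero + x (suc i)  ≈⟨ +-congʳ (-‿distribˡ-* _ _) ⟨
      - (x (suc i) * u * x zero) + x (suc i)  ≈⟨ +-congʳ (-‿cong (*-assoc _ _ _)) ⟩
      - (x (suc i) * (u * x zero)) + x (suc i) ≈⟨ +-congʳ (-‿cong (*-congˡ (trans (*-comm u _) xu≈1))) ⟩
      - (x (suc i) * 1#) + x (suc i)          ≈⟨ +-congʳ (-‿cong (*-identityʳ _)) ⟩
      - x (suc i) + x (suc i)                 ≈⟨ -‿inverseˡ _ ⟩
      0#                                      ∎

  permutationMatrix : Permutation′ n → Matrix n
  permutationMatrix π i = I (π ⟨$⟩ʳ i)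

  permutationMatrix-invertible : (π : Permutation′ n) → Invertible (permutationMatrix π)
  permutationMatrix-invertible π = permutationMatrix (flip π) , inverse-of π , inverse-of (flip π)
    where
    inverse-of : ∀ π → (permutationMatrix π ⊗ permutationMatrix (flip π)) ≈M I
    inverse-of π i j =
      trans (sumF-δˡ (π ⟨$⟩ʳ i) (λ k → I (π ⟨$⟩ˡ k) j)) (reflexive (≡.cong (λ k → I k j) (inverseˡ π)))

  column₀-completion : (π : Permutation′ (suc n)) (x : Vector Carrier (suc n)) {u : Carrier} →
                       x (π ⟨$⟩ˡ zero) * u ≈ 1# →
                       Σ (Matrix (suc n)) λ A → Invertible A × column₀ A ≋ x
  column₀-completion π x xu≈1 =
    permutationMatrix π ⊗ I[col₀≔ x′ ] ,
    Invertible-⊗ {A = permutationMatrix π} {I[col₀≔ x′ ]}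
                 (permutationMatrix-invertible π) (I[col₀≔]-invertible x′ xu≈1) ,
    λ i → trans (sumF-δˡ (π ⟨$⟩ʳ i) x′) (reflexive (≡.cong x (inverseˡ π)))
    where
    x′ = x ∘ (π ⟨$⟩ˡ_)

  nonzero-column₀-completion : Decidable _≈_ → {x : Vector Carrier (suc n)} → ¬ x ≋ 0ᵥ →
                               Σ (Matrix (suc n)) λ A → Invertible A × column₀ A ≋ x
  nonzero-column₀-completion _≟_ {x} x≉0 =
    let p , xₚ≉0 = ¬∀⟶∃¬ _ (λ i → x i ≈ 0#) (λ i → x i ≟ 0#) x≉0
        _ , xₚu≈1 = inverse (x p) xₚ≉0
    in column₀-completion (transpose p zero) x xₚu≈1

  topRow : Matrix (suc n) → Vector Carrier n
  topRow A j = A zero (suc j)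

  minor : Matrix (suc n) → Matrix n
  minor A i j = A (suc i) (suc j)

  unitBlock : Vector Carrier n → Matrix n → Matrix (suc n)
  unitBlock r D zero    zero    = 1#
  unitBlock r D zero    (suc j) = r j
  unitBlock r D (suc i) zero    = 0#
  unitBlock r D (suc i) (suc j) = D i j

  unitBlock-cong : {r s : Vector Carrier n} {D E : Matrix n} →
                   r ≋ s → D ≈M E → unitBlock r D ≈M unitBlock s E
  unitBlock-cong r≋s D≈E zero    zero    = refl
  unitBlock-cong r≋s D≈E zero    (suc j) = r≋s j
  unitBlock-cong r≋s D≈E (suc i) zero    = refl
  unitBlock-cong r≋s D≈E (suc i) (suc j) = D≈E i j

  unitBlock-0ᵥ-I : unitBlock 0ᵥ I ≈M I {suc n}
  unitBlock-0ᵥ-I zero    zero    = refl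
  unitBlock-0ᵥ-I zero    (suc j) = refl
  unitBlock-0ᵥ-I (suc i) zero    = refl
  unitBlock-0ᵥ-I (suc i) (suc j) = sym (reflexive (I-suc i j))

  unitBlock-⊗ : (r s : Vector Carrier n) (D E : Matrix n) →
                (unitBlock r D ⊗ unitBlock s E) ≈M unitBlock (λ j → s j + (r ᵥ⊗ E) j) (D ⊗ E)
  unitBlock-⊗ r s D E zero    zero    =
    trans (+-cong (*-identityˡ 1#) (sumF-0 (λ k → zeroʳ (r k)))) (+-identityʳ 1#)
  unitBlock-⊗ r s D E zero    (suc j) = +-congʳ (*-identityˡ (s j))
  unitBlock-⊗ r s D E (suc i) zero    =
    trans (+-cong (zeroˡ 1#) (sumF-0 (λ k → zeroʳ (D i k)))) (+-identityʳ 0#)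
  unitBlock-⊗ r s D E (suc i) (suc j) = trans (+-congʳ (zeroˡ (s j))) (+-identityˡ _)

  unitBlock-⊗≈I : {r s : Vector Carrier n} {D E : Matrix n} →
                  (∀ j → s j + (r ᵥ⊗ E) j ≈ 0#) → (D ⊗ E) ≈M I →
                  (unitBlock r D ⊗ unitBlock s E) ≈M I
  unitBlock-⊗≈I {r = r} {s} {D} {E} s+rE≈0 DE≈I =
    M.trans (unitBlock-⊗ r s D E) (M.trans (unitBlock-cong s+rE≈0 DE≈I) unitBlock-0ᵥ-I)

  unitBlock-invertible : (r : Vector Carrier n) {D : Matrix n} → Invertible D → Invertible (unitBlock r D)
  unitBlock-invertible r {D} (D⁻¹ , DD⁻¹ , D⁻¹D) =
    Invertible-resp factorisation (Invertible-⊗ {A = unitBlock 0ᵥ D} {unitBlock r I} diagonal shear)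
    where
    0ᵥ+0ᵥ≈0 : ∀ {n} (A : Matrix n) j → 0ᵥ j + (0ᵥ ᵥ⊗ A) j ≈ 0#
    0ᵥ+0ᵥ≈0 A j = trans (+-identityˡ _) (sumF-0 (λ k → zeroˡ (A k j)))
    diagonal : Invertible (unitBlock 0ᵥ D)
    diagonal = unitBlock 0ᵥ D⁻¹ ,
      unitBlock-⊗≈I (0ᵥ+0ᵥ≈0 D⁻¹) DD⁻¹ , unitBlock-⊗≈I (0ᵥ+0ᵥ≈0 D) D⁻¹D
    shear : Invertible (unitBlock r I)
    shear = unitBlock (-_ ∘ r) I ,
      unitBlock-⊗≈I (λ j → trans (+-congˡ (sumF-δʳ j r)) (-‿inverseˡ (r j))) (⊗-identityˡ I) ,
      unitBlock-⊗≈I (λ j → trans (+-congˡ (sumF-δʳ j (-_ ∘ r))) (-‿inverseʳ (r j))) (⊗-identityˡ I)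
    factorisation : (unitBlock 0ᵥ D ⊗ unitBlock r I) ≈M unitBlock r D
    factorisation = M.trans (unitBlock-⊗ 0ᵥ r D I)
      (unitBlock-cong (λ j → trans (+-congˡ (sumF-0 (λ k → zeroˡ (I k j)))) (+-identityʳ (r j)))
                      (⊗-identityʳ D))

  unitBlock-η : {A : Matrix (suc n)} → column₀ A ≋ e₀ → unitBlock (topRow A) (minor A) ≈M A
  unitBlock-η A₀≋e₀ zero    zero    = sym (A₀≋e₀ zero)
  unitBlock-η A₀≋e₀ zero    (suc j) = refl
  unitBlock-η A₀≋e₀ (suc i) zero    = sym (A₀≋e₀ (suc i))
  unitBlock-η A₀≋e₀ (suc i) (suc j) = refl

  minor-⊗ : (A B : Matrix (suc n)) → column₀ A ≋ e₀ → minor (A ⊗ B) ≈M (minor A ⊗ minor B)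
  minor-⊗ A B A₀≋e₀ i j =
    trans (+-congʳ (trans (*-congʳ (A₀≋e₀ (suc i))) (zeroˡ (B zero (suc j))))) (+-identityˡ _)

  minor-invertible : {A : Matrix (suc n)} → Invertible A → column₀ A ≋ e₀ → Invertible (minor A)
  minor-invertible {A = A} (A⁻¹ , AA⁻¹ , A⁻¹A) A₀≋e₀ =
    minor A⁻¹ ,
    M.trans (M.sym (minor-⊗ A A⁻¹ A₀≋e₀)) (minor-I AA⁻¹) ,
    M.trans (M.sym (minor-⊗ A⁻¹ A A⁻¹₀≋e₀)) (minor-I A⁻¹A)
    where
    minor-I : {B : Matrix (suc _)} → B ≈M I → minor B ≈M I
    minor-I B≈I i j = trans (B≈I (suc i) (suc j)) (reflexive (I-suc i j))
    A⁻¹₀≋e₀ : column₀ A⁻¹ ≋ e₀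
    A⁻¹₀≋e₀ i =
      trans (sym (⊗ᵥ-e₀ A⁻¹ i)) (trans (⊗ᵥ-congʳ A⁻¹ (λ k → sym (A₀≋e₀ k)) i) (A⁻¹A i zero))

  column₀-e₀-inverse : Inverse (GL (suc n) (λ A → column₀ A ≋ e₀))
                               (≋-setoid n ×ₛ GL n (λ _ → ⊤))
  column₀-e₀-inverse = mkInverse
    (λ (A , A-inv , A₀≋e₀) → topRow A , minor A , minor-invertible {A = A} A-inv A₀≋e₀ , tt)
    (λ (r , D , D-inv , _) →
       unitBlock r D , unitBlock-invertible r D-inv , λ { zero → refl ; (suc i) → refl })
    (λ A≈B → (λ j → A≈B zero (suc j)) , (λ i j → A≈B (suc i) (suc j)))
    (λ (r≋s , D≈E) → unitBlock-cong r≋s D≈E)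
    (λ _ → (λ j → refl) , (λ i j → refl))
    (λ (_ , _ , A₀≋e₀) → unitBlock-η A₀≋e₀)

  column₀-transport : {A : Matrix (suc n)} {x : Vector Carrier (suc n)} → Invertible A → column₀ A ≋ x →
                      Inverse (GL (suc n) (λ B → column₀ B ≋ e₀)) (GL (suc n) (λ B → column₀ B ≋ x))
  column₀-transport {A = A} (A⁻¹ , AA⁻¹ , A⁻¹A) A₀≋x = GL-⊗ˡ-inverse A A⁻¹ AA⁻¹ A⁻¹A
    (λ B₀≋e₀ i → trans (⊗ᵥ-congʳ A B₀≋e₀ i) (trans (⊗ᵥ-e₀ A i) (A₀≋x i)))
    (λ B₀≋x i →
       trans (⊗ᵥ-congʳ A⁻¹ (λ k → trans (B₀≋x k) (sym (A₀≋x k))) i) (A⁻¹A i zero))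

  column₀-fibre-inverse : Decidable _≈_ → {x : Vector Carrier (suc n)} → ¬ x ≋ 0ᵥ →
                          Inverse (GL (suc n) (λ A → column₀ A ≋ x)) (≋-setoid n ×ₛ GL n (λ _ → ⊤))
  column₀-fibre-inverse _≟_ x≉0 =
    let A , A-inv , A₀≋x = nonzero-column₀-completion _≟_ x≉0
    in Symmetry.inverse (column₀-transport {A = A} A-inv A₀≋x) ⨾ column₀-e₀-inverse

  column₀-nonzero : {A : Matrix (suc n)} → Invertible A → ¬ column₀ A ≋ 0ᵥ
  column₀-nonzero (A⁻¹ , _ , A⁻¹A) A₀≋0 =
    0≉1 (trans (sym (sumF-0 (λ k → trans (*-congˡ (A₀≋0 k)) (zeroʳ (A⁻¹ zero k))))) (A⁻¹A zero zero))

  NonzeroWithSum : ℕ → Carrier → Setoid (c ⊔ ℓ) ℓ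
  NonzeroWithSum n a = Subsetoid (≋-setoid n) (λ x → sumF x ≈ a × ¬ x ≋ 0ᵥ)

  1ᵥ : Vector Carrier n
  1ᵥ _ = 1#

  GLsum-column₀ : (a : Carrier) → Inverse (GLsum (suc n) a) (GL (suc n) (λ B → sumF (column₀ B) ≈ a))
  GLsum-column₀ {n} a =
    let J⁻¹ , JJ⁻¹ , J⁻¹J = I[col₀≔]-invertible 1ᵥ (*-identityˡ 1#)
    in GL-⊗ʳ-inverse J J⁻¹ JJ⁻¹ J⁻¹J
      (λ {A} ΣA≈a → trans (sym (entrySum-column₀ A)) ΣA≈a)
      (λ {B} ΣB₀≈a → trans (entrySum-column₀ (B ⊗ J⁻¹))
                       (trans (sumF-cong (λ i → ⊗-cancelʳ {A = J⁻¹} {J} J⁻¹J B i zero)) ΣB₀≈a))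
    where
    J = I[col₀≔ 1ᵥ {suc n} ]
    entrySum-column₀ : ∀ A → entrySum A ≈ sumF (column₀ (A ⊗ J))
    entrySum-column₀ A = sumF-cong (λ i → sumF-cong (λ k → sym (*-identityʳ (A i k))))

  fixed-sum-inverse : (a : Carrier) →
                      Inverse (≋-setoid n) (Subsetoid (≋-setoid (suc n)) (λ x → sumF x ≈ a))
  fixed-sum-inverse a = mkInverse
    (λ w → (a - sumF w) ∷ w , //-rightDividesˡ (sumF w) a) (λ (x , _) → tail x)
    (λ w≋w′ → λ { zero → +-congˡ (-‿cong (sumF-cong w≋w′)) ; (suc i) → w≋w′ i }) (λ x≋y → x≋y ∘ suc)
    (λ (x , Σx≈a) → λ { zero → trans (+-congʳ (sym Σx≈a)) (//-rightDividesʳ _ (x zero)) ; (suc i) → refl })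
    (λ _ _ → refl)

  -- Counting over a finite field

  module _ {q : ℕ} (card : HasCard setoid q) where

    private
      _≟_ : Decidable _≈_
      _≟_ = HasCard-decidable card

    vectors-card : ∀ n → HasCard (≋-setoid n) (q ^ n)
    vectors-card zero    =
      mkInverse (λ _ ()) (λ _ → zero) (λ _ ()) (λ _ → ≡.refl) (λ _ ()) (λ { zero → ≡.refl })
    vectors-card (suc n) = HasCard-× card (vectors-card n) ⨾ mkInverse
      (λ (x , v) → x ∷ v) (λ v → head v , tail v)
      (λ (x≈y , v≋w) → λ { zero → x≈y ; (suc i) → v≋w i }) (λ v≋w → v≋w zero , v≋w ∘ suc)
      (λ v → λ { zero → refl ; (suc i) → refl }) (λ _ → refl , λ i → refl)

    GL-column₀-card : {R : Vector Carrier (suc n) → Set p} →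
                      (∀ {x y} → x ≋ y → R x → R y) → (∀ {x} → R x → ¬ x ≋ 0ᵥ) →
                      ∀ {N G} → HasCard (Subsetoid (≋-setoid (suc n)) R) N → HasCard (GL n (λ _ → ⊤)) G →
                      HasCard (GL (suc n) (R ∘ column₀)) (N ℕ.* (q ^ n ℕ.* G))
    GL-column₀-card {n} {R = R} R-resp R⇒≉0 cardR cardGL = HasCard-fibres h cardR λ (x , Rx) →
      HasCard-× (vectors-card n) cardGL ⨾ Symmetry.inverse (column₀-fibre-inverse _≟_ (R⇒≉0 Rx)) ⨾
      Symmetry.inverse (Subsetoid-∩ ⨾ Subsetoid-cong
        (λ ((A-inv , _) , A₀≋x) → A-inv , A₀≋x)
        (λ (A-inv , A₀≋x) → (A-inv , R-resp (λ i → sym (A₀≋x i)) Rx) , A₀≋x))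
      where
      h : Func (GL (suc n) (R ∘ column₀)) (Subsetoid (≋-setoid (suc n)) R)
      h = record { to = λ (A , _ , RA₀) → column₀ A , RA₀ ; cong = λ A≈B i → A≈B i zero }

    GL-card : ∀ n → HasCard (GL n (λ _ → ⊤)) (∣GL∣ q n)
    GL-card zero    = mkInverse (λ _ → (λ ()) , ((λ ()) , (λ ()) , (λ ())) , tt) (λ _ → zero)
                                (λ _ ()) (λ _ → ≡.refl) (λ _ ()) (λ { zero → ≡.refl })
    GL-card (suc n) =
      GL-column₀-card ≉0ᵥ-resp (λ x≉0 → x≉0) (HasCard-remove (vectors-card (suc n)) 0ᵥ) (GL-card n) ⨾
      Subsetoid-cong (λ (A-inv , _) → A-inv , tt) (λ {A} (A-inv , _) → A-inv , column₀-nonzero {A = A} A-inv)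

    NonzeroWithSum-0-card : HasCard (NonzeroWithSum (suc n) 0#) (q ^ n ∸ 1)
    NonzeroWithSum-0-card {n} =
      HasCard-remove (vectors-card n ⨾ fixed-sum-inverse 0#) (0ᵥ , sumF-0 {suc n} {0ᵥ} (λ _ → refl)) ⨾
      Subsetoid-∩

    NonzeroWithSum-≉0-card : {a : Carrier} → ¬ a ≈ 0# → HasCard (NonzeroWithSum (suc n) a) (q ^ n)
    NonzeroWithSum-≉0-card {n} {a} a≉0 = vectors-card n ⨾ fixed-sum-inverse a ⨾
      Subsetoid-cong (λ Σx≈a → Σx≈a , λ x≋0 → a≉0 (trans (sym Σx≈a) (sumF-0 x≋0))) proj₁

    GLsum-card : (a : Carrier) → ∀ {N} → HasCard (NonzeroWithSum (suc n) a) N →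
                 HasCard (GLsum (suc n) a) (N ℕ.* (q ^ n ℕ.* ∣GL∣ q n))
    GLsum-card {n} a cardN =
      GL-column₀-card (λ x≋y (Σx≈a , x≉0) → trans (sym (sumF-cong x≋y)) Σx≈a , ≉0ᵥ-resp x≋y x≉0)
                      proj₂ cardN (GL-card n) ⨾
      Subsetoid-cong (λ (A-inv , ΣA₀≈a , _) → A-inv , ΣA₀≈a)
                     (λ {A} (A-inv , ΣA₀≈a) → A-inv , ΣA₀≈a , column₀-nonzero {A = A} A-inv) ⨾
      Symmetry.inverse (GLsum-column₀ a)

-- The closed forms

open import Data.Nat using (_≤_; _*_; _+_)
open import Relation.Binary.PropositionalEquality using (setoid)
open import Data.Nat.Properties using (*-zeroʳ; ^-distribˡ-+-*)
open import Data.Nat.Combinatorics using (_C_; nC1≡n; nCk+nC[k+1]≡[n+1]C[k+1])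
open import Data.Nat.Tactic.RingSolver using (solve-∀)
open ≡.≡-Reasoning

q^n∸1≡[n]q*[q∸1] : ∀ q n → q ^ n ∸ 1 ≡ qint q n * (q ∸ 1)
q^n∸1≡[n]q*[q∸1] zero    zero    = ≡.refl
q^n∸1≡[n]q*[q∸1] zero    (suc n) = ≡.sym (*-zeroʳ (qint 0 (suc n)))
q^n∸1≡[n]q*[q∸1] (suc p) n       = ≡.cong (_∸ 1) (q^n≡1+[n]q*[q∸1] n)
  where
  q^n≡1+[n]q*[q∸1] : ∀ n → suc p ^ n ≡ suc (qint (suc p) n * p)
  q^n≡1+[n]q*[q∸1] zero    = ≡.refl
  q^n≡1+[n]q*[q∸1] (suc n) rewrite q^n≡1+[n]q*[q∸1] n = expand p (qint (suc p) n)
    where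
    expand : ∀ p x → suc p * suc (x * p) ≡ suc ((suc (x * p) + x) * p)
    expand = solve-∀

q^[1+n]C2 : ∀ q n → q ^ (suc n C 2) ≡ q ^ n * q ^ (n C 2)
q^[1+n]C2 q n = ≡.trans (≡.cong (q ^_) [1+n]C2≡n+nC2) (^-distribˡ-+-* q n (n C 2))
  where
  [1+n]C2≡n+nC2 : suc n C 2 ≡ n + n C 2
  [1+n]C2≡n+nC2 = ≡.trans (≡.sym (nCk+nC[k+1]≡[n+1]C[k+1] n 1)) (≡.cong (_+ n C 2) (nC1≡n n))

∣GL∣-closed-form : ∀ q n → ∣GL∣ q n ≡ qfact q n * (q ∸ 1) ^ n * q ^ (n C 2)
∣GL∣-closed-form q zero    = ≡.refl
∣GL∣-closed-form q (suc n) = begin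
  (q ^ suc n ∸ 1) * (q ^ n * ∣GL∣ q n)
    ≡⟨ ≡.cong₂ (λ a b → a * (q ^ n * b)) (q^n∸1≡[n]q*[q∸1] q (suc n)) (∣GL∣-closed-form q n) ⟩
  qint q (suc n) * (q ∸ 1) * (q ^ n * (qfact q n * (q ∸ 1) ^ n * q ^ (n C 2)))
    ≡⟨ rearrange (qint q (suc n)) (q ∸ 1) (q ^ n) (qfact q n) ((q ∸ 1) ^ n) (q ^ (n C 2)) ⟩
  qint q (suc n) * qfact q n * ((q ∸ 1) * (q ∸ 1) ^ n) * (q ^ n * q ^ (n C 2))
    ≡⟨ ≡.cong (qfact q (suc n) * (q ∸ 1) ^ suc n *_) (q^[1+n]C2 q n) ⟨
  qfact q (suc n) * (q ∸ 1) ^ suc n * q ^ (suc n C 2) ∎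
  where
  rearrange : ∀ a d b f e g → a * d * (b * (f * e * g)) ≡ a * f * (d * e) * (b * g)
  rearrange = solve-∀

zero-sum-count : ∀ q m → (q ^ m ∸ 1) * (q ^ m * ∣GL∣ q m) ≡
                 qfact q m * (q ∸ 1) ^ m * q ^ (suc m C 2) * (q ^ m ∸ 1)
zero-sum-count q m rewrite ∣GL∣-closed-form q m | q^[1+n]C2 q m =
  rearrange (q ^ m ∸ 1) (q ^ m) (qfact q m) ((q ∸ 1) ^ m) (q ^ (m C 2))
  where
  rearrange : ∀ a b f e g → a * (b * (f * e * g)) ≡ f * e * (b * g) * a
  rearrange = solve-∀

nonzero-sum-count : ∀ q m → q ^ m * (q ^ m * ∣GL∣ q m) ≡ qfact q m * (q ∸ 1) ^ m * q ^ (suc m C 2 + m)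
nonzero-sum-count q m
  rewrite ^-distribˡ-+-* q (suc m C 2) m | q^[1+n]C2 q m | ∣GL∣-closed-form q m =
  rearrange (q ^ m) (qfact q m) ((q ∸ 1) ^ m) (q ^ (m C 2))
  where
  rearrange : ∀ b f e g → b * (b * (f * e * g)) ≡ f * e * (b * g * b)
  rearrange = solve-∀

corollary3p2 : ∀ {c ℓ} (F : Field c ℓ) (q : ℕ)
    → Inverse (setoid (Fin q)) (Field.setoid F)
    → (n : ℕ) → 1 ≤ n
    → HasCard (MatrixDefs.GLsum F n (Field.0# F))
        (qfact q (n ∸ 1) * (q ∸ 1) ^ (n ∸ 1) * q ^ (n C 2) * (q ^ (n ∸ 1) ∸ 1))
      × (∀ (a : Field.Carrier F) → ¬ (Field._≈_ F a (Field.0# F))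
          → HasCard (MatrixDefs.GLsum F n a)
              (qfact q (n ∸ 1) * (q ∸ 1) ^ (n ∸ 1) * q ^ (n C 2 + (n ∸ 1))))
corollary3p2 F q card zero    ()
corollary3p2 F q card (suc m) _ =
  ≡.subst (HasCard _) (zero-sum-count q m) (GLsum-card F card (Field.0# F) (NonzeroWithSum-0-card F card)) ,
  λ a a≉0 →
    ≡.subst (HasCard _) (nonzero-sum-count q m) (GLsum-card F card a (NonzeroWithSum-≉0-card F card a≉0))
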